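{- Let $G$ be a deterministic and arc-symmetric graph and let $r$ be a root of $G$. Then for all $s,t\in V_G$ there is a unique $x$ with $(s,t,x)\in\mathrm{Path}_G(r)$, so that the path-operation $\ast_r$ (with $s\ast_r t$ this unique $x$) is defined, and $(V_G,\ast_r)$ is a left-cancellative monoid with identity $r$, generated as a monoid by the set $\to_G(r)=\{s: r\to_G s\}$ of successors of $r$. If moreover $G$ is co-deterministic, then $\ast_r$ is cancellative. If moreover $G$ is simple, then $G=\mathcal{C}\langle V_G,\to_G(r)\rangle$ for the operation $\ast_r$, where $\langle s\rangle=a$ whenever $r\xrightarrow{a}_G s$.
   Context: A graph is a non-empty set $G\subseteq V\times A\times V$ of labeled edges $s\xrightarrow{a}_G t$; $s\to_G t$ means there is such an edge for some $a$; $V_G$ is the set of vertices occurring in edges, $A_G$ the set of labels; $s\xrightarrow{u}_G t$ for $u\in A_G^*$ denotes a path labeled $u$. A root is a vertex from which every vertex is reachable. $G$ is deterministic if $r\xrightarrow{a}s$, $r\xrightarrow{a}t$ imply $s=t$; co-deterministic if $s\xrightarrow{a}r$, $t\xrightarrow{a}r$ imply $s=t$; simple if no two edges share source and target. $G_{\downarrow s}$ is the subgraph induced by the vertices reachable from $s$; $G$ is arc-symmetric if for all $s,t\in V_G$ there is an isomorphism of labeled graphs from $G_{\downarrow s}$ to $G_{\downarrow t}$ mapping $s$ to $t$. The path-relation $\mathrm{Path}_G(r)$ is the set of triples $(s,t,x)$ of vertices such that there is $u\in A_G^*$ with $r\xrightarrow{u}_G t$ and $s\xrightarrow{u}_G x$.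 For a magma $(M,\cdot)$, $Q\subseteq M$ and injective $\langle\,\rangle:Q\to A$, $\mathcal{C}\langle M,Q\rangle=\{(p,\langle q\rangle,p\cdot q): p\in M,\ q\in Q\}$. A magma is left-cancellative if $r\cdot p=r\cdot q\Rightarrow p=q$, cancellative if in addition $p\cdot r=q\cdot r\Rightarrow p=q$. -}

module Defs where

open import Data.List using (List; []; _∷_; foldr)
open import Data.List.Relation.Unary.All using (All)
open import Data.Product using (Σ; ∃; _×_; _,_; proj₁)
open import Data.Sum using (_⊎_)
open import Relation.Binary.PropositionalEquality using (_≡_)
open import Function.Bundles using (_⇔_)

-- A labelled graph with vertex type V and label type A is given by its edge
-- relation  E s a t  (meaning s --a--> t).  The vertex set V_G is modelled by
-- the type V together with the hypothesis that every element of V occurs in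
-- some edge (see IsVertex).

module _ {V A : Set} (E : V → A → V → Set) where

  IsVertex : V → Set
  IsVertex v = (∃ λ a → ∃ λ t → E v a t) ⊎ (∃ λ a → ∃ λ s → E s a v)

  data Path : V → List A → V → Set where
    ε    : ∀ {s} → Path s [] s
    step : ∀ {s a t u x} → E s a t → Path t u x → Path s (a ∷ u) x

  Reach : V → V → Set
  Reach s t = ∃ λ u → Path s u t

  IsRoot : V → Set
  IsRoot r = ∀ v → Reach r v

  Arrow : V → V → Set
  Arrow s t = ∃ λ a → E s a t

  Deterministic : Set
  Deterministic = ∀ {r a s t} → E r a s → E r a t → s ≡ t

  CoDeterministic : Set
  CoDeterministic = ∀ {r a s t} → E s a r → E t a r → s ≡ t

  Simple : Set
  Simple = ∀ {s t a b} → E s a t → E s b t → a ≡ b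

  -- vertices of G↓s (reachability proofs carried along; equality is
  -- equality of the underlying vertices)
  Down : V → Set
  Down s = Σ V (Reach s)

  -- an isomorphism of labelled graphs G↓s ≅ G↓t mapping s to t
  -- (G↓s is the induced subgraph on vertices reachable from s)
  record DownIso (s t : V) : Set where
    field
      to      : Down s → Down t
      from    : Down t → Down s
      to-wd   : ∀ x y → proj₁ x ≡ proj₁ y → proj₁ (to x) ≡ proj₁ (to y)
      from-wd : ∀ x y → proj₁ x ≡ proj₁ y → proj₁ (from x) ≡ proj₁ (from y)
      from-to : ∀ x → proj₁ (from (to x)) ≡ proj₁ x
      to-from : ∀ y → proj₁ (to (from y)) ≡ proj₁ y
      edges   : ∀ x a y → E (proj₁ x) a (proj₁ y) ⇔ E (proj₁ (to x)) a (proj₁ (to y))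
      root    : proj₁ (to (s , [] , ε)) ≡ t

  ArcSymmetric : Set
  ArcSymmetric = ∀ s t → DownIso s t

  PathRel : V → V → V → V → Set
  PathRel r s t x = ∃ λ u → Path r u t × Path s u x

  GeneratedBy : (_*_ : V → V → V) → V → (V → Set) → Set
  GeneratedBy _*_ e P = ∀ v → ∃ λ (l : List V) → All P l × v ≡ foldr _*_ e l

  -- G = C⟨V_G, →_G(r)⟩ for the operation _*_, with ⟨q⟩ = a iff r --a--> q
  IsCayley : (_*_ : V → V → V) → V → Set
  IsCayley _*_ r = ∀ p a x → E p a x ⇔ (∃ λ q → E r a q × x ≡ p * q)

-- Arc-symmetry carries every path from r labelled u to a path from s labelled u,
-- and by determinism its end depends only on s and on the end t of the first
-- path: this is s * t.  Every monoid law is then an instance of that uniqueness,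
-- applied to concatenations of transported paths.  Left cancellation is the
-- injectivity of the isomorphism G↓r ≅ G↓s, right cancellation is
-- co-determinism read backwards along a path, and an edge p --a--> x transported
-- to r gives x = p * q with r --a--> q, which both yields the Cayley description
-- and, peeled off edge by edge, the generation by the successors of r.

module Submission where

open import Defs
open import Data.Product using (Σ; _×_; _,_; proj₁; proj₂; ∃)
open import Relation.Binary.PropositionalEquality
  using (_≡_; refl; sym; trans; cong₂; subst; isEquivalence; module ≡-Reasoning)
open import Function.Bundles using (_⇔_; mk⇔; Equivalence)
open import Algebra.Structures using (IsMonoid)
open import Algebra.Definitions using (LeftCancellative; RightCancellative; Cancellative)
open import Data.List using (List; []; _∷_; _++_; [_]; foldr)
open import Data.List.Relation.Unary.All using (All; []; _∷_)

module Paths {V A : Set} (E : V → A → V → Set) where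

  _++ᵖ_ : ∀ {s u t w x} → Path E s u t → Path E t w x → Path E s (u ++ w) x
  ε        ++ᵖ q = q
  step e p ++ᵖ q = step e (p ++ᵖ q)

  edge⇒path : ∀ {s a t} → E s a t → Path E s [ a ] t
  edge⇒path e = step e ε

  path⇒edge : ∀ {s a t} → Path E s [ a ] t → E s a t
  path⇒edge (step e ε) = e

  Reach-extend : ∀ {s t a x} → Reach E s t → E t a x → Reach E s x
  Reach-extend (u , p) e = u ++ [ _ ] , p ++ᵖ edge⇒path e

  Deterministic⇒unique-target : Deterministic E →
    ∀ {s u x y} → Path E s u x → Path E s u y → x ≡ y
  Deterministic⇒unique-target D ε          ε            = refl
  Deterministic⇒unique-target D (step e p) (step e′ p′) with D e e′
  ... | refl = Deterministic⇒unique-target D p p′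

  CoDeterministic⇒unique-source : CoDeterministic E →
    ∀ {s t u x} → Path E s u x → Path E t u x → s ≡ t
  CoDeterministic⇒unique-source C ε          ε            = refl
  CoDeterministic⇒unique-source C (step e p) (step e′ p′)
    with CoDeterministic⇒unique-source C p p′
  ... | refl = C e e′

  module _ {s t : V} (I : DownIso E s t) where
    open DownIso I

    to-injective : ∀ x y → proj₁ (to x) ≡ proj₁ (to y) → proj₁ x ≡ proj₁ y
    to-injective x y eq = begin
      proj₁ x                ≡⟨ sym (from-to x) ⟩
      proj₁ (from (to x))    ≡⟨ from-wd (to x) (to y) eq ⟩
      proj₁ (from (to y))    ≡⟨ from-to y ⟩
      proj₁ y                ∎
      where open ≡-Reasoning

    transport-path : ∀ {x u y} (ρx : Reach E s x) → Path E x u y → (ρy : Reach E s y) →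
      Path E (proj₁ (to (x , ρx))) u (proj₁ (to (y , ρy)))
    transport-path {x} ρx ε ρy =
      subst (Path E (proj₁ (to (x , ρx))) []) (to-wd (x , ρx) (x , ρy) refl) ε
    transport-path ρx (step {t = x′} e p) ρy =
      step (Equivalence.to (edges (_ , ρx) _ (x′ , Reach-extend ρx e)) e)
           (transport-path (Reach-extend ρx e) p ρy)

    transport-from-root : ∀ {u y} → Path E s u y → (ρy : Reach E s y) →
      Path E t u (proj₁ (to (y , ρy)))
    transport-from-root p ρy = subst (λ z → Path E z _ _) root (transport-path ([] , ε) p ρy)

module PathOperation {V A : Set} {E : V → A → V → Set}
  (D : Deterministic E) (AS : ArcSymmetric E) {r : V} (rooted : IsRoot E r) where

  open Paths E

  infixl 7 _*_
  _*_ : V → V → V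
  s * t = proj₁ (DownIso.to (AS r s) (t , rooted t))

  shift : ∀ s {u t} → Path E r u t → Path E s u (s * t)
  shift s {t = t} p = transport-from-root (AS r s) p (rooted t)

  *-unique : ∀ {s u t x} → Path E r u t → Path E s u x → x ≡ s * t
  *-unique {s} p q = Deterministic⇒unique-target D q (shift s p)

  pathRel⇔* : ∀ s t x → PathRel E r s t x ⇔ (x ≡ s * t)
  pathRel⇔* s t x = mk⇔ (λ (_ , p , q) → *-unique p q)
                        (λ { refl → proj₁ (rooted t) , proj₂ (rooted t) , shift s (proj₂ (rooted t)) })

  *-assoc : ∀ s t v → (s * t) * v ≡ s * (t * v)
  *-assoc s t v = *-unique (pt ++ᵖ shift t pv) (shift s pt ++ᵖ shift (s * t) pv)
    where
    pt = proj₂ (rooted t)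
    pv = proj₂ (rooted v)

  *-identityˡ : ∀ t → r * t ≡ t
  *-identityˡ t = sym (*-unique (proj₂ (rooted t)) (proj₂ (rooted t)))

  *-identityʳ : ∀ s → s * r ≡ s
  *-identityʳ s = sym (*-unique ε ε)

  *-isMonoid : IsMonoid _≡_ _*_ r
  *-isMonoid = record
    { isSemigroup = record
      { isMagma = record { isEquivalence = isEquivalence ; ∙-cong = cong₂ _*_ }
      ; assoc   = *-assoc }
    ; identity = *-identityˡ , *-identityʳ }

  *-cancelˡ : LeftCancellative _≡_ _*_
  *-cancelˡ s t v = to-injective (AS r s) (t , rooted t) (v , rooted v)

  *-cancelʳ : CoDeterministic E → RightCancellative _≡_ _*_
  *-cancelʳ C s t v eq =
    CoDeterministic⇒unique-source C (shift t p) (subst (Path E v _) (sym eq) (shift v p))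
    where p = proj₂ (rooted s)

  edge⇒* : ∀ {p a x} → E p a x → ∃ λ q → E r a q × x ≡ p * q
  edge⇒* {p} {a} {x} e = q , r-a→q , *-unique (edge⇒path r-a→q) (edge⇒path e)
    where
    ρx : Reach E p x
    ρx = [ a ] , edge⇒path e
    q = proj₁ (DownIso.to (AS p r) (x , ρx))
    r-a→q : E r a q
    r-a→q = path⇒edge (transport-from-root (AS p r) (edge⇒path e) ρx)

  isCayley : IsCayley E _*_ r
  isCayley p a x = mk⇔ edge⇒* λ { (q , e , refl) → path⇒edge (shift p (edge⇒path e)) }

  path⇒product : ∀ {s u v} → Path E s u v →
    ∃ λ (l : List V) → All (Arrow E r) l × v ≡ s * foldr _*_ r l
  path⇒product {s} ε = [] , [] , sym (*-identityʳ s)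
  path⇒product {s} (step e p) with edge⇒* e | path⇒product p
  ... | q , r-a→q , refl | l , gens , v≡ =
    q ∷ l , (_ , r-a→q) ∷ gens , trans v≡ (*-assoc s q (foldr _*_ r l))

  *-generatedBy : GeneratedBy E _*_ r (Arrow E r)
  *-generatedBy v with path⇒product (proj₂ (rooted v))
  ... | l , gens , v≡ = l , gens , trans v≡ (*-identityˡ _)

proposition3p5 : {V A : Set} (E : V → A → V → Set) →
    (∀ v → IsVertex E v) → Deterministic E → ArcSymmetric E →
    (r : V) → IsRoot E r →
    Σ (V → V → V) (λ _*_ →
      (∀ s t x → PathRel E r s t x ⇔ (x ≡ s * t))
      × IsMonoid _≡_ _*_ r
      × LeftCancellative _≡_ _*_
      × GeneratedBy E _*_ r (Arrow E r)
      × (CoDeterministic E → Cancellative _≡_ _*_)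
      × (Simple E → IsCayley E _*_ r))
proposition3p5 E _ D AS r rooted =
  _*_ , pathRel⇔* , *-isMonoid , *-cancelˡ , *-generatedBy ,
  (λ C → *-cancelˡ , *-cancelʳ C) , (λ _ → isCayley)
  where open PathOperation D AS rooted
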